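{- Let $(G,c)$ be a bicolored graph with vertex set $[n]$. The following are equivalent: (1) the vertices of $G$ in the usual order $1,2,\dots,n$ form a successful pressing sequence; (2) $A(G)=LL^T$ for some invertible lower-triangular matrix $L$ over $\mathbb{F}_2$; (3) every leading principal minor of $A(G)$ (of size $j\in[n]$) is nonzero over $\mathbb{F}_2$; (4) the induced subgraph $\hat G[\{1,\dots,j\}]$ has an odd number of perfect matchings for each $j\in[n]$; (5) $A(G)=LU$ for some invertible lower-triangular $L$ and invertible upper-triangular $U$ over $\mathbb{F}_2$.
   Context: A bicolored graph is a pair $(G,c)$ with $G$ a finite simple graph and $c:V(G)\to\{\text{black},\text{white}\}$. The augmented adjacency matrix $A(G)\in\mathbb{F}_2^{n\times n}$ is the adjacency matrix of $G$ with diagonal entry $1$ at black and $0$ at white vertices. Pressing a black vertex $v$ complements the induced subgraph on the closed neighborhood $N^\ast(v)=N(v)\cup\{v\}$ and flips the color of each vertex of $N^\ast(v)$, leaving everything else unchanged. A pressing sequence is a sequence of vertices each of which is black at the moment it is pressed; it is successful if the final graph has no edges and all vertices white. The loopy graph $\hat G$ has the vertices and edges of $G$ plus a loop at each black vertex; a perfect matching of a loopy graph is a set of edges (loops allowed) covering each vertex exactly once, a loop counting once for its vertex. -}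

module Defs where

open import Data.Bool using (Bool; true; false; not; _∧_; _∨_; _xor_; if_then_else_)
open import Data.Nat using (ℕ; zero; suc; _≤_; _<_)
open import Data.Fin using (Fin; zero; suc; _≟_; inject≤; toℕ)
open import Data.List using (List; []; _∷_; map; foldr; concatMap; allFin)
open import Data.Product using (Σ; _×_; _,_)
open import Relation.Nullary.Decidable using (⌊_⌋)
open import Relation.Binary.PropositionalEquality using (_≡_)

-- F₂ is represented by Bool: false = 0, true = 1, _xor_ = +, _∧_ = *.
-- Colors: true = black, false = white.

Matrix : ℕ → Set
Matrix n = Fin n → Fin n → Bool

-- A finite simple bicolored graph on vertex set Fin n (= [n], vertex i ↦ i+1).
record BiGraph (n : ℕ) : Set where
  field
    adj    : Fin n → Fin n → Bool
    sym    : ∀ u w → adj u w ≡ adj w u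
    irrefl : ∀ u → adj u u ≡ false
    black  : Fin n → Bool

open BiGraph public

augAdj : ∀ {n} → BiGraph n → Matrix n
augAdj G i j = if ⌊ i ≟ j ⌋ then black G i else adj G i j

record State (n : ℕ) : Set where
  constructor st
  field
    edge  : Fin n → Fin n → Bool
    color : Fin n → Bool

open State public

toState : ∀ {n} → BiGraph n → State n
toState G = st (adj G) (black G)

inN* : ∀ {n} → State n → Fin n → Fin n → Bool
inN* s v u = ⌊ u ≟ v ⌋ ∨ edge s v u

press : ∀ {n} → State n → Fin n → State n
press s v = st e c
  where
  e : _ → _ → Bool
  e u w = if inN* s v u ∧ inN* s v w ∧ not ⌊ u ≟ w ⌋ then not (edge s u w) else edge s u w
  c : _ → Bool
  c u = if inN* s v u then not (color s u) else color s u

Successful : ∀ {n} → State n → List (Fin n) → Set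
Successful s [] = (∀ u w → edge s u w ≡ false) × (∀ u → color s u ≡ false)
Successful s (v ∷ vs) = (color s v ≡ true) × Successful (press s v) vs

xorSum : List Bool → Bool
xorSum = foldr _xor_ false

andAll : List Bool → Bool
andAll = foldr _∧_ true

_⊗_ : ∀ {n} → Matrix n → Matrix n → Matrix n
(A ⊗ B) i k = xorSum (map (λ j → A i j ∧ B j k) (allFin _))

transpose : ∀ {n} → Matrix n → Matrix n
transpose A i j = A j i

idM : ∀ {n} → Matrix n
idM i j = ⌊ i ≟ j ⌋

_≐_ : ∀ {n} → Matrix n → Matrix n → Set
A ≐ B = ∀ i j → A i j ≡ B i j

Invertible : ∀ {n} → Matrix n → Set
Invertible {n} L = Σ (Matrix n) λ M → ((L ⊗ M) ≐ idM) × ((M ⊗ L) ≐ idM)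

LowerTriangular : ∀ {n} → Matrix n → Set
LowerTriangular L = ∀ i j → toℕ i < toℕ j → L i j ≡ false

UpperTriangular : ∀ {n} → Matrix n → Set
UpperTriangular U = ∀ i j → toℕ j < toℕ i → U i j ≡ false

-- Enumeration of all functions Fin m → Fin k (each exactly once).
consF : ∀ {m k} → Fin k → (Fin m → Fin k) → Fin (suc m) → Fin k
consF x f zero = x
consF x f (suc i) = f i

allFuns : ∀ m k → List (Fin m → Fin k)
allFuns zero k = (λ ()) ∷ []
allFuns (suc m) k = concatMap (λ f → map (λ x → consF x f) (allFin k)) (allFuns m k)

isInjective : ∀ {m} → (Fin m → Fin m) → Bool
isInjective {m} f =
  andAll (concatMap (λ i → map (λ j → ⌊ i ≟ j ⌋ ∨ not ⌊ f i ≟ f j ⌋) (allFin m)) (allFin m))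

-- Determinant over F₂ by the Leibniz formula (signs are 1 in F₂):
-- det A = Σ_{σ ∈ S_m} Π_i A i (σ i).
det : ∀ {m} → Matrix m → Bool
det {m} A =
  xorSum (map (λ σ → isInjective σ ∧ andAll (map (λ i → A i (σ i)) (allFin m))) (allFuns m m))

leading : ∀ {n j} → j ≤ n → Matrix n → Matrix j
leading j≤n A a b = A (inject≤ a j≤n) (inject≤ b j≤n)

-- A perfect matching of a loopy graph on Fin m with edge relation e and loops at
-- vertices with ℓ = true is identified with its partner map f : Fin m → Fin m,
-- an involution with: f i = i ⇒ loop at i, f i ≠ i ⇒ edge {i, f i}.
isPerfectMatching : ∀ {m} → (Fin m → Fin m → Bool) → (Fin m → Bool) → (Fin m → Fin m) → Bool
isPerfectMatching {m} e ℓ f =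
  andAll (map (λ i → ⌊ f (f i) ≟ i ⌋ ∧ (if ⌊ f i ≟ i ⌋ then ℓ i else e i (f i))) (allFin m))

pmParity : ∀ {m} → (Fin m → Fin m → Bool) → (Fin m → Bool) → Bool
pmParity {m} e ℓ = xorSum (map (isPerfectMatching e ℓ) (allFuns m m))

loopyPMParity : ∀ {n j} → j ≤ n → BiGraph n → Bool
loopyPMParity j≤n G =
  pmParity (λ a b → adj G (inject≤ a j≤n) (inject≤ b j≤n)) (λ a → black G (inject≤ a j≤n))

module Submission where

-- All five conditions are
-- compared with one notion, Pivotable A: Gaussian elimination on A without row
-- exchanges meets only unit pivots (A₀₀ = 1, then recursively on the Schur
-- complement).

open import Defs hiding (sym)
open import Data.Bool using (Bool; true; false; not; _∧_; _∨_; _xor_; if_then_else_)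
open import Data.Bool.Properties
  using (not-involutive; ∧-comm; ∧-assoc; ∧-zeroʳ; ∧-identityʳ; xor-assoc; xor-comm; xor-identityʳ; xor-same;
         ∧-distribˡ-xor; ∧-distribʳ-xor)
open import Data.Fin using (Fin; zero; suc; _≟_; punchOut; inject≤)
open import Data.Fin.Properties using (all?; punchOut-injective; <⇒notInjective; suc-injective; inject≤-injective)
open import Data.List using (List; []; _∷_; map; concatMap; allFin; _++_; filter; length)
open import Data.List.Properties using (map-tabulate; length-filter; filter-all)
open import Data.List.Membership.Propositional using (_∈_)
open import Data.List.Membership.Propositional.Properties using (∈-allFin)
import Data.List.Membership.Setoid as MembershipS
import Data.List.Membership.Setoid.Properties as MembershipProps
open import Data.List.Relation.Binary.Disjoint.Setoid using (Disjoint)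
open import Data.List.Relation.Unary.All using (All; []; _∷_)
import Data.List.Relation.Unary.All as All
import Data.List.Relation.Unary.All.Properties as All
open import Data.List.Relation.Unary.AllPairs using ([]; _∷_)
import Data.List.Relation.Unary.AllPairs as AllPairs
import Data.List.Relation.Unary.AllPairs.Properties as AllPairs
open import Data.List.Relation.Unary.Any using (here; there)
import Data.List.Relation.Unary.Any as Any
import Data.List.Relation.Unary.Any.Properties as Any
open import Data.List.Relation.Unary.Unique.Propositional.Properties using (allFin⁺)
import Data.List.Relation.Unary.Unique.Setoid as UniqueS
import Data.List.Relation.Unary.Unique.Setoid.Properties as UniqueProps
open import Data.Maybe using (Maybe; just; nothing; fromMaybe)
import Data.Maybe as Maybe
open import Data.Nat using (ℕ; zero; suc; _≤_; _<_; z≤n; s≤s)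
open import Data.Nat.Properties using (≤-refl; ≤-trans; n<1+n)
open import Data.Product using (Σ; _×_; _,_; proj₁; proj₂; ∃)
open import Data.Sum using (_⊎_; inj₁; inj₂)
open import Data.Unit using (⊤; tt)
open import Function using (_∘_; id)
open import Function.Bundles using (_⇔_; mk⇔)
open import Function.Construct.Composition using (_⇔-∘_)
open import Function.Definitions using (Injective)
open import Level using (0ℓ)
open import Relation.Binary.Bundles using (Setoid)
open import Relation.Binary.Definitions using (Decidable)
open import Relation.Nullary using (¬_; yes; no)
open import Relation.Nullary.Negation using (contradiction)
open import Relation.Nullary.Decidable using (⌊_⌋; ¬?)
open import Relation.Binary.PropositionalEquality
  using (_≡_; _≢_; _≗_; refl; sym; trans; cong; cong₂; subst; setoid; _→-setoid_; module ≡-Reasoning)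

bool-⇔ : ∀ {a b : Bool} → (a ≡ true → b ≡ true) → (b ≡ true → a ≡ true) → a ≡ b
bool-⇔ {false} {false} _ _ = refl
bool-⇔ {false} {true}  _ g = g refl
bool-⇔ {true}  {false} f _ = sym (f refl)
bool-⇔ {true}  {true}  _ _ = refl

true≢false : true ≢ false
true≢false ()

≢true : ∀ {b : Bool} → ¬ (b ≡ true) → b ≡ false
≢true {false} _ = refl
≢true {true}  h = contradiction refl h

∧-trueˡ : ∀ {a b} → a ∧ b ≡ true → a ≡ true
∧-trueˡ {true} _ = refl

∧-trueʳ : ∀ {a b} → a ∧ b ≡ true → b ≡ true
∧-trueʳ {true} p = p

∧-true : ∀ {a b} → a ≡ true → b ≡ true → a ∧ b ≡ true
∧-true refl refl = refl

xor-≡false : ∀ {a b} → a xor b ≡ false → a ≡ b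
xor-≡false {false} {false} _ = refl
xor-≡false {true}  {true}  _ = refl

xor-cancelˡ : ∀ a b → a xor (a xor b) ≡ b
xor-cancelˡ false b = refl
xor-cancelˡ true  b = not-involutive b

xor-leftComm : ∀ a b c → a xor (b xor c) ≡ b xor (a xor c)
xor-leftComm a b c = trans (sym (xor-assoc a b c)) (trans (cong (_xor c) (xor-comm a b)) (xor-assoc b a c))

∧-leftComm : ∀ a b c → a ∧ (b ∧ c) ≡ b ∧ (a ∧ c)
∧-leftComm a b c = trans (sym (∧-assoc a b c)) (trans (cong (_∧ c) (∧-comm a b)) (∧-assoc b a c))

xor-interchange : ∀ a b c d → (a xor b) xor (c xor d) ≡ (a xor c) xor (b xor d)
xor-interchange a b c d = begin
  (a xor b) xor (c xor d)  ≡⟨ xor-assoc a b (c xor d) ⟩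
  a xor (b xor (c xor d))  ≡⟨ cong (a xor_) (xor-leftComm b c d) ⟩
  a xor (c xor (b xor d))  ≡⟨ sym (xor-assoc a c (b xor d)) ⟩
  (a xor c) xor (b xor d)  ∎
  where open ≡-Reasoning

≟-refl : ∀ {m} (i : Fin m) → ⌊ i ≟ i ⌋ ≡ true
≟-refl i with i ≟ i
... | yes _ = refl
... | no i≢i = contradiction refl i≢i

≟-≢ : ∀ {m} {i j : Fin m} → i ≢ j → ⌊ i ≟ j ⌋ ≡ false
≟-≢ {i = i} {j} i≢j with i ≟ j
... | yes i≡j = contradiction i≡j i≢j
... | no _    = refl

≟-sound : ∀ {m} {i j : Fin m} → ⌊ i ≟ j ⌋ ≡ true → i ≡ j
≟-sound {i = i} {j} p with i ≟ j
... | yes i≡j = i≡j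

≟-sym : ∀ {m} (i j : Fin m) → ⌊ i ≟ j ⌋ ≡ ⌊ j ≟ i ⌋
≟-sym i j with i ≟ j | j ≟ i
... | yes _   | yes _   = refl
... | no _    | no _    = refl
... | yes i≡j | no j≢i  = contradiction (sym i≡j) j≢i
... | no i≢j  | yes j≡i = contradiction (sym j≡i) i≢j

≟-suc : ∀ {m} (i j : Fin m) → ⌊ suc i ≟ suc j ⌋ ≡ ⌊ i ≟ j ⌋
≟-suc i j with i ≟ j
... | yes _ = refl
... | no _  = refl

sumOver : ∀ {A : Set} → (A → Bool) → List A → Bool
sumOver f l = xorSum (map f l)

sum-++ : ∀ {A : Set} (f : A → Bool) (l l′ : List A) →
  sumOver f (l ++ l′) ≡ sumOver f l xor sumOver f l′
sum-++ f [] l′ = refl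
sum-++ f (x ∷ l) l′ = trans (cong (f x xor_) (sum-++ f l l′)) (sym (xor-assoc (f x) _ _))

sum-concatMap : ∀ {A B : Set} (f : B → Bool) (g : A → List B) (l : List A) →
  sumOver f (concatMap g l) ≡ sumOver (λ a → sumOver f (g a)) l
sum-concatMap f g [] = refl
sum-concatMap f g (x ∷ l) = trans (sum-++ f (g x) (concatMap g l)) (cong (sumOver f (g x) xor_) (sum-concatMap f g l))

sum-map : ∀ {A B : Set} (f : B → Bool) (g : A → B) (l : List A) →
  sumOver f (map g l) ≡ sumOver (f ∘ g) l
sum-map f g [] = refl
sum-map f g (x ∷ l) = cong (f (g x) xor_) (sum-map f g l)

sum-cong : ∀ {A : Set} {f g : A → Bool} (l : List A) → (∀ a → f a ≡ g a) → sumOver f l ≡ sumOver g l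
sum-cong [] e = refl
sum-cong (x ∷ l) e = cong₂ _xor_ (e x) (sum-cong l e)

sum-xor : ∀ {A : Set} (f g : A → Bool) (l : List A) →
  sumOver (λ a → f a xor g a) l ≡ sumOver f l xor sumOver g l
sum-xor f g [] = refl
sum-xor f g (x ∷ l) = trans (cong ((f x xor g x) xor_) (sum-xor f g l)) (xor-interchange (f x) (g x) _ _)

sum-∧ˡ : ∀ {A : Set} (c : Bool) (f : A → Bool) (l : List A) → sumOver (λ a → c ∧ f a) l ≡ c ∧ sumOver f l
sum-∧ˡ c f [] = sym (∧-zeroʳ c)
sum-∧ˡ c f (x ∷ l) = trans (cong ((c ∧ f x) xor_) (sum-∧ˡ c f l)) (sym (∧-distribˡ-xor c (f x) _))

sum-∧ʳ : ∀ {A : Set} (c : Bool) (f : A → Bool) (l : List A) → sumOver (λ a → f a ∧ c) l ≡ sumOver f l ∧ c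
sum-∧ʳ c f [] = refl
sum-∧ʳ c f (x ∷ l) = trans (cong ((f x ∧ c) xor_) (sum-∧ʳ c f l)) (sym (∧-distribʳ-xor c (f x) _))

sum-zero : ∀ {A : Set} (f : A → Bool) (l : List A) → (∀ a → f a ≡ false) → sumOver f l ≡ false
sum-zero f [] _ = refl
sum-zero f (x ∷ l) e rewrite e x = sum-zero f l e

sum-swap : ∀ {A B : Set} (f : A → B → Bool) (l : List A) (l′ : List B) →
  sumOver (λ a → sumOver (f a) l′) l ≡ sumOver (λ b → sumOver (λ a → f a b) l) l′
sum-swap f [] l′ = sym (sum-zero _ l′ (λ _ → refl))
sum-swap f (x ∷ l) l′ = trans (cong (sumOver (f x) l′ xor_) (sum-swap f l l′))
  (sym (sum-xor (f x) (λ b → sumOver (λ a → f a b) l) l′))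

sum-witness : ∀ {A : Set} (f : A → Bool) (l : List A) → sumOver f l ≡ true → ∃ λ a → f a ≡ true
sum-witness f (x ∷ l) p with f x in fx
... | true  = x , fx
... | false = sum-witness f l p

allFin-suc : ∀ {A : Set} m (f : Fin (suc m) → A) → map f (allFin (suc m)) ≡ f zero ∷ map (f ∘ suc) (allFin m)
allFin-suc m f = cong (f zero ∷_) (trans (map-tabulate suc f) (sym (map-tabulate id (f ∘ suc))))

allFin-unfold : ∀ n → allFin (suc n) ≡ zero ∷ map suc (allFin n)
allFin-unfold n = cong (zero ∷_) (sym (map-tabulate id suc))

sumFin : ∀ m → (Fin m → Bool) → Bool
sumFin m f = sumOver f (allFin m)

sumFin-suc : ∀ m (f : Fin (suc m) → Bool) → sumFin (suc m) f ≡ f zero xor sumFin m (f ∘ suc)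
sumFin-suc m f = cong xorSum (allFin-suc m f)

sumFin-δ : ∀ m (i : Fin m) (a : Fin m → Bool) → sumFin m (λ j → ⌊ i ≟ j ⌋ ∧ a j) ≡ a i
sumFin-δ (suc m) zero a = trans (sumFin-suc m (λ j → ⌊ zero ≟ j ⌋ ∧ a j))
  (trans (cong (a zero xor_) (sum-zero _ (allFin m) (λ _ → refl))) (xor-identityʳ (a zero)))
sumFin-δ (suc m) (suc i) a = trans (sumFin-suc m (λ j → ⌊ suc i ≟ j ⌋ ∧ a j))
  (trans (sum-cong (allFin m) (λ j → cong (_∧ a (suc j)) (≟-suc i j))) (sumFin-δ m i (a ∘ suc)))

andAll-++ : ∀ (l l′ : List Bool) → andAll (l ++ l′) ≡ andAll l ∧ andAll l′
andAll-++ []          l′ = refl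
andAll-++ (false ∷ l) l′ = refl
andAll-++ (true ∷ l)  l′ = andAll-++ l l′

andAll-concatMap : ∀ {A : Set} (g : A → List Bool) (l : List A) →
  andAll (concatMap g l) ≡ andAll (map (andAll ∘ g) l)
andAll-concatMap g []      = refl
andAll-concatMap g (x ∷ l) = trans (andAll-++ (g x) (concatMap g l)) (cong (andAll (g x) ∧_) (andAll-concatMap g l))

andAll-allFin⁻ : ∀ m (h : Fin m → Bool) → andAll (map h (allFin m)) ≡ true → ∀ i → h i ≡ true
andAll-allFin⁻ (suc m) h p i with trans (sym (cong andAll (allFin-suc m h))) p
andAll-allFin⁻ (suc m) h p zero    | q = ∧-trueˡ q
andAll-allFin⁻ (suc m) h p (suc i) | q = andAll-allFin⁻ m (h ∘ suc) (∧-trueʳ {h zero} q) i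

andAll-allFin⁺ : ∀ m (h : Fin m → Bool) → (∀ i → h i ≡ true) → andAll (map h (allFin m)) ≡ true
andAll-allFin⁺ zero h p = refl
andAll-allFin⁺ (suc m) h p = trans (cong andAll (allFin-suc m h)) (∧-true (p zero) (andAll-allFin⁺ m (h ∘ suc) (p ∘ suc)))

-- The involution principle mod 2: if τ is a fixed-point-free involution of the
-- support of H, the terms of Σ H pair off and the sum vanishes.  Stated for a
-- duplicate-free list closed under τ, with elements compared up to a setoid
-- (the lists we need enumerate functions, compared pointwise).

module Involution (S : Setoid 0ℓ 0ℓ) (_≈?_ : Decidable (Setoid._≈_ S)) where

  open Setoid S renaming (Carrier to X; refl to ≈-refl; sym to ≈-sym; trans to ≈-trans)
  open MembershipS S using () renaming (_∈_ to _∈ₛ_)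
  open UniqueS S using (Unique)

  record FreeInvolution (H : X → Bool) (τ : X → X) : Set where
    field
      H-resp     : ∀ {x y} → x ≈ y → H x ≡ H y
      τ-cong     : ∀ {x y} → x ≈ y → τ x ≈ τ y
      involutive : ∀ x → H x ≡ true → τ (τ x) ≈ x
      supported  : ∀ x → H x ≡ true → H (τ x) ≡ true
      fixfree    : ∀ x → H x ≡ true → ¬ (τ x ≈ x)

  Closed : (X → Bool) → (X → X) → List X → Set
  Closed H τ l = ∀ y → y ∈ₛ l → H y ≡ true → τ y ∈ₛ l

  ∉-resp : ∀ {x y xs} → All (λ z → ¬ x ≈ z) xs → x ≈ y → ¬ (y ∈ₛ xs)
  ∉-resp (x≉z ∷ _)  x≈y (here y≈z)  = x≉z (≈-trans x≈y y≈z)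
  ∉-resp (_   ∷ ps) x≈y (there y∈) = ∉-resp ps x≈y y∈

  without : X → List X → List X
  without a = filter (λ y → ¬? (a ≈? y))

  module _ {H : X → Bool} {τ : X → X} (inv : FreeInvolution H τ) where

    open FreeInvolution inv

    sum-without : ∀ a l → Unique l → a ∈ₛ l → sumOver H l ≡ H a xor sumOver H (without a l)
    sum-without a (y ∷ ys) (y∉ys ∷ ys!) a∈ with a ≈? y
    ... | yes a≈y = cong₂ _xor_ (sym (H-resp a≈y))
            (cong (sumOver H) (sym (filter-all (λ z → ¬? (a ≈? z)) (All.map (λ y≉z a≈z → y≉z (≈-trans (≈-sym a≈y) a≈z)) y∉ys))))
    sum-without a (y ∷ ys) (_ ∷ ys!) (here a≈y)   | no a≉y = contradiction a≈y a≉y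
    sum-without a (y ∷ ys) (_ ∷ ys!) (there a∈ys) | no _ =
      trans (cong (H y xor_) (sum-without a ys ys! a∈ys)) (xor-leftComm (H y) (H a) _)

    -- Induction on the length of the list: the head pairs with τ of itself.
    sum-vanishes′ : ∀ n l → length l ≤ n → Unique l → Closed H τ l → sumOver H l ≡ false
    sum-vanishes′ _ [] _ _ _ = refl
    sum-vanishes′ (suc n) (x ∷ xs) (s≤s len) (x∉xs ∷ xs!) closed with H x in Hx
    ... | false = sum-vanishes′ n xs len xs! closed-xs
      where
      closed-xs : Closed H τ xs
      closed-xs y y∈ Hy with closed y (there y∈) Hy
      ... | here τy≈x  = contradiction (trans (sym (supported y Hy)) (trans (H-resp τy≈x) Hx)) true≢false
      ... | there τy∈ = τy∈
    ... | true = begin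
      true xor sumOver H xs                    ≡⟨ cong (true xor_) (sum-without (τ x) xs xs! τx∈xs) ⟩
      true xor (H (τ x) xor sumOver H xs′)     ≡⟨ cong (λ b → true xor (b xor sumOver H xs′)) (supported x Hx) ⟩
      true xor (true xor sumOver H xs′)        ≡⟨ xor-cancelˡ true (sumOver H xs′) ⟩
      sumOver H xs′                            ≡⟨ sum-vanishes′ n xs′ (≤-trans (length-filter _ xs) len)
                                                    (UniqueProps.filter⁺ S _ xs!) closed-xs′ ⟩
      false                                    ∎
      where
      open ≡-Reasoning
      xs′ : List X
      xs′ = without (τ x) xs
      τx∈xs : τ x ∈ₛ xs
      τx∈xs with closed x (here ≈-refl) Hx
      ... | here τx≈x = contradiction τx≈x (fixfree x Hx)
      ... | there τx∈ = τx∈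
      resp : ∀ {y z} → y ≈ z → ¬ (τ x ≈ y) → ¬ (τ x ≈ z)
      resp y≈z τx≉y τx≈z = τx≉y (≈-trans τx≈z (≈-sym y≈z))
      closed-xs′ : Closed H τ xs′
      closed-xs′ y y∈ Hy with MembershipProps.∈-filter⁻ S (λ z → ¬? (τ x ≈? z)) resp y∈
      ... | y∈xs , τx≉y with closed y (there y∈xs) Hy
      ... | here τy≈x  = contradiction (≈-trans (≈-sym (τ-cong τy≈x)) (involutive y Hy)) τx≉y
      ... | there τy∈ = MembershipProps.∈-filter⁺ S (λ z → ¬? (τ x ≈? z)) resp τy∈
              (λ τx≈τy → ∉-resp x∉xs (≈-trans (≈-sym (involutive x Hx)) (≈-trans (τ-cong τx≈τy) (involutive y Hy))) y∈xs)

    sum-vanishes : ∀ l → Unique l → Closed H τ l → sumOver H l ≡ false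
    sum-vanishes l = sum-vanishes′ (length l) l ≤-refl

FunSetoid : ℕ → ℕ → Setoid 0ℓ 0ℓ
FunSetoid m k = Fin m →-setoid Fin k

_≗?_ : ∀ {m k} → Decidable (_≗_ {A = Fin m} {B = Fin k})
f ≗? g = all? (λ i → f i ≟ g i)

extensions : ∀ {m} k → (Fin m → Fin k) → List (Fin (suc m) → Fin k)
extensions k f = map (λ x → consF x f) (allFin k)

allFuns-complete : ∀ m k (f : Fin m → Fin k) → MembershipS._∈_ (FunSetoid m k) f (allFuns m k)
allFuns-complete zero    k f = here (λ ())
allFuns-complete (suc m) k f =
  MembershipProps.∈-concat⁺ (FunSetoid (suc m) k)
    (Any.map⁺ (Any.map extends (allFuns-complete m k (f ∘ suc))))
  where
  extends : ∀ {g} → f ∘ suc ≗ g → MembershipS._∈_ (FunSetoid (suc m) k) f (extensions k g)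
  extends {g} tail≗g = Any.map⁺ (Any.map (λ { refl → λ { zero → refl ; (suc i) → tail≗g i } }) (∈-allFin (f zero)))

allFuns-unique : ∀ m k → UniqueS.Unique (FunSetoid m k) (allFuns m k)
allFuns-unique zero    k = [] ∷ []
allFuns-unique (suc m) k =
  UniqueProps.concat⁺ (FunSetoid (suc m) k)
    (All.map⁺ (All.tabulate (λ {g} _ → rows-unique g)))
    (AllPairs.map⁺ (AllPairs.map rows-disjoint (allFuns-unique m k)))
  where
  rows-unique : ∀ g → UniqueS.Unique (FunSetoid (suc m) k) (extensions k g)
  rows-unique g = UniqueProps.map⁺ (setoid (Fin k)) (FunSetoid (suc m) k) (λ e → e zero) (allFin⁺ k)
  rows-disjoint : ∀ {g h} → ¬ (g ≗ h) → Disjoint (FunSetoid (suc m) k) (extensions k g) (extensions k h)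
  rows-disjoint g≉h (f∈g , f∈h) with MembershipProps.∈-map⁻ (setoid (Fin k)) (FunSetoid (suc m) k) f∈g
                                  | MembershipProps.∈-map⁻ (setoid (Fin k)) (FunSetoid (suc m) k) f∈h
  ... | _ , _ , f≗xg | _ , _ , f≗yh = g≉h (λ i → trans (sym (f≗xg (suc i))) (f≗yh (suc i)))

sumFuns : ∀ m k → ((Fin m → Fin k) → Bool) → Bool
sumFuns m k H = sumOver H (allFuns m k)

Respects≗ : ∀ {m k} → ((Fin m → Fin k) → Bool) → Set
Respects≗ H = ∀ {f g} → f ≗ g → H f ≡ H g

sumFuns-cong : ∀ m k {H H′ : (Fin m → Fin k) → Bool} → (∀ f → H f ≡ H′ f) → sumFuns m k H ≡ sumFuns m k H′
sumFuns-cong m k = sum-cong (allFuns m k)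

sumFuns-suc : ∀ m k (H : (Fin (suc m) → Fin k) → Bool) →
  sumFuns (suc m) k H ≡ sumFuns m k (λ g → sumFin k (λ x → H (consF x g)))
sumFuns-suc m k H = trans (sum-concatMap H (extensions k) (allFuns m k)) (sum-cong (allFuns m k) (λ g → sum-map H _ (allFin k)))

PairsOff : ∀ {m k} → ((Fin m → Fin k) → Bool) → ((Fin m → Fin k) → Fin m → Fin k) → Set
PairsOff {m} {k} = Involution.FreeInvolution (FunSetoid m k) _≗?_

sumFuns-involution : ∀ m k (H : (Fin m → Fin k) → Bool) (τ : (Fin m → Fin k) → Fin m → Fin k) →
  PairsOff H τ → sumFuns m k H ≡ false
sumFuns-involution m k H τ inv =
  Involution.sum-vanishes (FunSetoid m k) _≗?_ inv (allFuns m k) (allFuns-unique m k) (λ y _ _ → allFuns-complete m k (τ y))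

sumFuns-avoiding-zero : ∀ m k (H : (Fin m → Fin (suc k)) → Bool) → Respects≗ H →
  (∀ f → H f ≡ true → ∀ i → f i ≢ zero) → sumFuns m (suc k) H ≡ sumFuns m k (λ g → H (suc ∘ g))
sumFuns-avoiding-zero zero    k H resp avoids = cong (_xor false) (resp (λ ()))
sumFuns-avoiding-zero (suc m) k H resp avoids = begin
  sumFuns (suc m) (suc k) H
    ≡⟨ sumFuns-suc m (suc k) H ⟩
  sumFuns m (suc k) (λ g → sumFin (suc k) (λ x → H (consF x g)))
    ≡⟨ sumFuns-cong m (suc k) (λ g → sumFin-suc k (λ x → H (consF x g))) ⟩
  sumFuns m (suc k) (λ g → H (consF zero g) xor H′ g)
    ≡⟨ sumFuns-cong m (suc k) (λ g → cong (_xor H′ g) (≢true (λ p → avoids _ p zero refl))) ⟩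
  sumFuns m (suc k) H′
    ≡⟨ sumFuns-avoiding-zero m k H′ resp′ avoids′ ⟩
  sumFuns m k (λ g → sumFin k (λ y → H (consF (suc y) (suc ∘ g))))
    ≡⟨ sumFuns-cong m k (λ g → sum-cong (allFin k) (λ y → resp (shift y g))) ⟩
  sumFuns m k (λ g → sumFin k (λ y → H (suc ∘ consF y g)))
    ≡⟨ sym (sumFuns-suc m k (λ g → H (suc ∘ g))) ⟩
  sumFuns (suc m) k (λ g → H (suc ∘ g)) ∎
  where
  open ≡-Reasoning
  H′ : (Fin m → Fin (suc k)) → Bool
  H′ g = sumFin k (λ y → H (consF (suc y) g))
  resp′ : Respects≗ H′
  resp′ e = sum-cong (allFin k) (λ y → resp (λ { zero → refl ; (suc i) → e i }))
  avoids′ : ∀ g → H′ g ≡ true → ∀ i → g i ≢ zero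
  avoids′ g p i with sum-witness _ (allFin k) p
  ... | y , q = avoids _ q (suc i)
  shift : ∀ y g → consF (suc y) (suc ∘ g) ≗ suc ∘ consF y g
  shift y g zero    = refl
  shift y g (suc i) = refl

injective⇒onto : ∀ {m} (σ : Fin m → Fin m) → Injective _≡_ _≡_ σ → ∀ j → ¬ (∀ i → σ i ≢ j)
injective⇒onto {suc m} σ σ-inj j misses = <⇒notInjective (n<1+n m) shrunk-inj
  where
  -- σ followed by closing the gap at j maps Fin (suc m) injectively into Fin m.
  j≢σ : ∀ i → j ≢ σ i
  j≢σ i j≡σi = misses i (sym j≡σi)
  shrunk : Fin (suc m) → Fin m
  shrunk i = punchOut (j≢σ i)
  shrunk-inj : Injective _≡_ _≡_ shrunk
  shrunk-inj {i} {i′} e = σ-inj (punchOut-injective (j≢σ i) (j≢σ i′) e)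

isInjective-sound : ∀ {m} (σ : Fin m → Fin m) → isInjective σ ≡ true → Injective _≡_ _≡_ σ
isInjective-sound {m} σ p {i} {j} σi≡σj with i ≟ j | σ i ≟ σ j | pair-test i j
  where
  pair-test : ∀ i j → ⌊ i ≟ j ⌋ ∨ not ⌊ σ i ≟ σ j ⌋ ≡ true
  pair-test i j = andAll-allFin⁻ m _ (andAll-allFin⁻ m _ (trans (sym (andAll-concatMap _ (allFin m))) p) i) j
... | yes i≡j | _        | _  = i≡j
... | no _    | yes _    | ()
... | no _    | no σi≢σj | _  = contradiction σi≡σj σi≢σj

isInjective-complete : ∀ {m} (σ : Fin m → Fin m) → Injective _≡_ _≡_ σ → isInjective σ ≡ true
isInjective-complete {m} σ σ-inj =
  trans (andAll-concatMap _ (allFin m)) (andAll-allFin⁺ m _ (λ i → andAll-allFin⁺ m _ (pair-test i)))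
  where
  pair-test : ∀ i j → ⌊ i ≟ j ⌋ ∨ not ⌊ σ i ≟ σ j ⌋ ≡ true
  pair-test i j with i ≟ j | σ i ≟ σ j
  ... | yes _   | _       = refl
  ... | no _    | no _    = refl
  ... | no i≢j  | yes σi≡σj = contradiction (σ-inj σi≡σj) i≢j

isInjective-resp : ∀ {m} → Respects≗ (isInjective {m})
isInjective-resp {f = f} {g} f≗g = bool-⇔
  (λ p → isInjective-complete g (λ {i} {j} e → isInjective-sound f p (trans (f≗g i) (trans e (sym (f≗g j))))))
  (λ p → isInjective-complete f (λ {i} {j} e → isInjective-sound g p (trans (sym (f≗g i)) (trans e (f≗g j)))))

-- The determinant over F₂

diagProduct : ∀ {m} → Matrix m → (Fin m → Fin m) → Bool
diagProduct {m} A σ = andAll (map (λ i → A i (σ i)) (allFin m))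

leibnizTerm : ∀ {m} → Matrix m → (Fin m → Fin m) → Bool
leibnizTerm A σ = isInjective σ ∧ diagProduct A σ

diagProduct⁻ : ∀ {m} (A : Matrix m) σ → diagProduct A σ ≡ true → ∀ i → A i (σ i) ≡ true
diagProduct⁻ {m} A σ = andAll-allFin⁻ m _

diagProduct⁺ : ∀ {m} (A : Matrix m) σ → (∀ i → A i (σ i) ≡ true) → diagProduct A σ ≡ true
diagProduct⁺ {m} A σ = andAll-allFin⁺ m _

diagProduct-cong : ∀ {m} (A B : Matrix m) {σ τ} → (∀ i → A i (σ i) ≡ B i (τ i)) → diagProduct A σ ≡ diagProduct B τ
diagProduct-cong A B e = bool-⇔ (λ p → diagProduct⁺ B _ (λ i → trans (sym (e i)) (diagProduct⁻ A _ p i)))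
                                (λ p → diagProduct⁺ A _ (λ i → trans (e i) (diagProduct⁻ B _ p i)))

leibnizTerm-resp : ∀ {m} (A : Matrix m) → Respects≗ (leibnizTerm A)
leibnizTerm-resp A σ≗τ = cong₂ _∧_ (isInjective-resp σ≗τ) (diagProduct-cong A A (λ i → cong (A i) (σ≗τ i)))

det-cong : ∀ {m} {A B : Matrix m} → A ≐ B → det A ≡ det B
det-cong {m} {A} {B} A≐B =
  sumFuns-cong m m {leibnizTerm A} {leibnizTerm B} (λ σ → cong (isInjective σ ∧_) (diagProduct-cong A B (λ i → A≐B i (σ i))))

det-1×1 : (A : Matrix 1) → det A ≡ A zero zero
det-1×1 A = trans (xor-identityʳ _) (∧-identityʳ (A zero zero))

withRow : ∀ {m} → Matrix m → Fin m → (Fin m → Bool) → Matrix m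
withRow A r v i j = if ⌊ i ≟ r ⌋ then v j else A i j

withRow-at : ∀ {m} (A : Matrix m) r v j → withRow A r v r j ≡ v j
withRow-at A r v j rewrite ≟-refl r = refl

withRow-off : ∀ {m} (A : Matrix m) {r i} v → i ≢ r → ∀ j → withRow A r v i j ≡ A i j
withRow-off A {r} {i} v i≢r j rewrite ≟-≢ i≢r = refl

withRow-same : ∀ {m} (A : Matrix m) r → withRow A r (A r) ≐ A
withRow-same A r i j with i ≟ r
... | yes refl = refl
... | no _     = refl

withRow-twice : ∀ {m} (A : Matrix m) r v w → withRow (withRow A r v) r w ≐ withRow A r w
withRow-twice A r v w i j with i ≟ r
... | yes _ = refl
... | no _  = refl

withRow-cong : ∀ {m} (A : Matrix m) r {v w : Fin m → Bool} → v ≗ w → withRow A r v ≐ withRow A r w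
withRow-cong A r v≗w i j with i ≟ r
... | yes _ = v≗w j
... | no _  = refl

diagProduct-split : ∀ {m} (X : Matrix m) r σ →
  diagProduct X σ ≡ X r (σ r) ∧ diagProduct (withRow X r (λ _ → true)) σ
diagProduct-split {m} X r σ = bool-⇔
  (λ p → ∧-true (diagProduct⁻ X σ p r) (diagProduct⁺ X₁ σ (λ i → others i (diagProduct⁻ X σ p i))))
  (λ p → diagProduct⁺ X σ (λ i → back i (∧-trueˡ p) (diagProduct⁻ X₁ σ (∧-trueʳ {X r (σ r)} p) i)))
  where
  X₁ : Matrix m
  X₁ = withRow X r (λ _ → true)
  others : ∀ i → X i (σ i) ≡ true → withRow X r (λ _ → true) i (σ i) ≡ true
  others i p with i ≟ r
  ... | yes _ = refl
  ... | no _  = p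
  back : ∀ i → X r (σ r) ≡ true → withRow X r (λ _ → true) i (σ i) ≡ true → X i (σ i) ≡ true
  back i pr p with i ≟ r
  ... | yes refl = pr
  ... | no _     = p

leibnizTerm-withRow : ∀ {m} (A : Matrix m) r v σ →
  leibnizTerm (withRow A r v) σ ≡ isInjective σ ∧ (v (σ r) ∧ diagProduct (withRow A r (λ _ → true)) σ)
leibnizTerm-withRow A r v σ = cong (isInjective σ ∧_) (trans (diagProduct-split (withRow A r v) r σ)
  (cong₂ _∧_ (withRow-at A r v (σ r)) (diagProduct-cong (withRow (withRow A r v) r (λ _ → true)) (withRow A r (λ _ → true)) (λ i → withRow-twice A r v (λ _ → true) i (σ i)))))

det-additive : ∀ {m} (A : Matrix m) r (u w : Fin m → Bool) →
  det (withRow A r (λ j → u j xor w j)) ≡ det (withRow A r u) xor det (withRow A r w)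
det-additive {m} A r u w = trans (sumFuns-cong m m split) (sum-xor (leibnizTerm (withRow A r u)) (leibnizTerm (withRow A r w)) (allFuns m m))
  where
  split : ∀ σ → leibnizTerm (withRow A r (λ j → u j xor w j)) σ ≡ leibnizTerm (withRow A r u) σ xor leibnizTerm (withRow A r w) σ
  split σ = begin
    leibnizTerm (withRow A r (λ j → u j xor w j)) σ   ≡⟨ leibnizTerm-withRow A r (λ j → u j xor w j) σ ⟩
    s ∧ ((u (σ r) xor w (σ r)) ∧ p)                   ≡⟨ cong (s ∧_) (∧-distribʳ-xor p (u (σ r)) (w (σ r))) ⟩
    s ∧ ((u (σ r) ∧ p) xor (w (σ r) ∧ p))             ≡⟨ ∧-distribˡ-xor s _ _ ⟩
    (s ∧ (u (σ r) ∧ p)) xor (s ∧ (w (σ r) ∧ p))       ≡⟨ sym (cong₂ _xor_ (leibnizTerm-withRow A r u σ) (leibnizTerm-withRow A r w σ)) ⟩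
    leibnizTerm (withRow A r u) σ xor leibnizTerm (withRow A r w) σ ∎
    where
    open ≡-Reasoning
    s p : Bool
    s = isInjective σ
    p = diagProduct (withRow A r (λ _ → true)) σ

swap : ∀ {m} → Fin m → Fin m → Fin m → Fin m
swap r s i with i ≟ r
... | yes _ = s
... | no _ with i ≟ s
...   | yes _ = r
...   | no _  = i

swap-r : ∀ {m} (r s : Fin m) → swap r s r ≡ s
swap-r r s with r ≟ r
... | yes _  = refl
... | no r≢r = contradiction refl r≢r

swap-s : ∀ {m} (r s : Fin m) → r ≢ s → swap r s s ≡ r
swap-s r s r≢s with s ≟ r
... | yes s≡r = contradiction (sym s≡r) r≢s
... | no _ with s ≟ s
...   | yes _  = refl
...   | no s≢s = contradiction refl s≢s

swap-other : ∀ {m} (r s i : Fin m) → i ≢ r → i ≢ s → swap r s i ≡ i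
swap-other r s i i≢r i≢s with i ≟ r
... | yes i≡r = contradiction i≡r i≢r
... | no _ with i ≟ s
...   | yes i≡s = contradiction i≡s i≢s
...   | no _    = refl

swap-involutive : ∀ {m} (r s : Fin m) → r ≢ s → ∀ i → swap r s (swap r s i) ≡ i
swap-involutive r s r≢s i with i ≟ r
... | yes refl = swap-s i s r≢s
... | no i≢r with i ≟ s
...   | yes refl = swap-r r i
...   | no i≢s   = swap-other r s i i≢r i≢s

position : ∀ {m} (r s i : Fin m) → i ≡ r ⊎ i ≡ s ⊎ (i ≢ r × i ≢ s)
position r s i with i ≟ r | i ≟ s
... | yes i≡r | _       = inj₁ i≡r
... | no _    | yes i≡s = inj₂ (inj₁ i≡s)
... | no i≢r  | no i≢s  = inj₂ (inj₂ (i≢r , i≢s))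

-- Composing with swap r s pairs off the permutations contributing to det A
-- when rows r and s agree.
det-equalRows : ∀ {m} (A : Matrix m) r s → r ≢ s → (∀ j → A r j ≡ A s j) → det A ≡ false
det-equalRows {m} A r s r≢s rows = sumFuns-involution m m (leibnizTerm A) (λ σ → σ ∘ swap r s) record
  { H-resp     = leibnizTerm-resp A
  ; τ-cong     = λ σ≗τ i → σ≗τ (swap r s i)
  ; involutive = λ σ _ i → cong σ (swap-involutive r s r≢s i)
  ; supported  = supported
  ; fixfree    = λ σ p σ∘swap≗σ → r≢s (isInjective-sound σ (∧-trueˡ p) (trans (sym (σ∘swap≗σ r)) (cong σ (swap-r r s))))
  }
  where
  supported : ∀ σ → leibnizTerm A σ ≡ true → leibnizTerm A (σ ∘ swap r s) ≡ true
  supported σ p = ∧-true (isInjective-complete _ swapped-inj) (diagProduct⁺ A _ entries)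
    where
    σ-inj : Injective _≡_ _≡_ σ
    σ-inj = isInjective-sound σ (∧-trueˡ p)
    onDiag : ∀ i → A i (σ i) ≡ true
    onDiag = diagProduct⁻ A σ (∧-trueʳ {isInjective σ} p)
    swapped-inj : Injective _≡_ _≡_ (σ ∘ swap r s)
    swapped-inj {i} {j} e = trans (sym (swap-involutive r s r≢s i)) (trans (cong (swap r s) (σ-inj e)) (swap-involutive r s r≢s j))
    entries : ∀ i → A i (σ (swap r s i)) ≡ true
    entries i with position r s i
    ... | inj₁ refl               = trans (cong (A i ∘ σ) (swap-r i s)) (trans (rows (σ s)) (onDiag s))
    ... | inj₂ (inj₁ refl)        = trans (cong (A i ∘ σ) (swap-s r i r≢s)) (trans (sym (rows (σ r))) (onDiag r))
    ... | inj₂ (inj₂ (i≢r , i≢s)) = trans (cong (A i ∘ σ) (swap-other r s i i≢r i≢s)) (onDiag i)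

det-rowOperation : ∀ {m} (A : Matrix m) r s c → r ≢ s →
  det (withRow A r (λ j → A r j xor (c ∧ A s j))) ≡ det A
det-rowOperation A r s false r≢s =
  det-cong (λ i j → trans (withRow-cong A r (λ j → xor-identityʳ (A r j)) i j) (withRow-same A r i j))
det-rowOperation A r s true r≢s = begin
  det (withRow A r (λ j → A r j xor A s j))           ≡⟨ det-additive A r (A r) (A s) ⟩
  det (withRow A r (A r)) xor det (withRow A r (A s))  ≡⟨ cong₂ _xor_ (det-cong (withRow-same A r))
                                                            (det-equalRows (withRow A r (A s)) r s r≢s equal) ⟩
  det A xor false                                      ≡⟨ xor-identityʳ (det A) ⟩
  det A                                                ∎
  where
  open ≡-Reasoning
  equal : ∀ j → withRow A r (A s) r j ≡ withRow A r (A s) s j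
  equal j = trans (withRow-at A r (A s) j) (sym (withRow-off A (A s) (λ s≡r → r≢s (sym s≡r)) j))

addPivotRow : ∀ {m} → (Fin m → Bool) → Matrix (suc m) → Matrix (suc m)
addPivotRow c B zero    j = B zero j
addPivotRow c B (suc i) j = B (suc i) j xor (c i ∧ B zero j)

-- Invariance of det, one row operation per index in rs, which lists the
-- rows with a possibly nonzero coefficient.
det-addPivotRow′ : ∀ {m} (B : Matrix (suc m)) rs (c : Fin m → Bool) → (∀ i → c i ≡ true → i ∈ rs) →
  det (addPivotRow c B) ≡ det B
det-addPivotRow′ B [] c supported = det-cong cleared
  where
  cleared : addPivotRow c B ≐ B
  cleared zero    j = refl
  cleared (suc i) j with c i in ci
  ... | false = xor-identityʳ (B (suc i) j)
  ... | true with () ← supported i ci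
det-addPivotRow′ {m} B (r ∷ rs) c supported = begin
  det (addPivotRow c B)
    ≡⟨ det-cong one-more-row ⟩
  det (withRow B′ (suc r) (λ j → B′ (suc r) j xor (c r ∧ B′ zero j)))
    ≡⟨ det-rowOperation B′ (suc r) zero (c r) (λ ()) ⟩
  det B′
    ≡⟨ det-addPivotRow′ B rs c′ supported′ ⟩
  det B ∎
  where
  open ≡-Reasoning
  c′ : Fin m → Bool
  c′ i = c i ∧ not ⌊ i ≟ r ⌋
  B′ : Matrix (suc m)
  B′ = addPivotRow c′ B
  supported′ : ∀ i → c′ i ≡ true → i ∈ rs
  supported′ i p with supported i (∧-trueˡ p)
  ... | here refl = contradiction (∧-trueʳ {c i} p) (λ q → true≢false (trans (sym q) (cong not (≟-refl i))))
  ... | there i∈rs = i∈rs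
  one-more-row : addPivotRow c B ≐ withRow B′ (suc r) (λ j → B′ (suc r) j xor (c r ∧ B′ zero j))
  one-more-row zero j = refl
  one-more-row (suc i) j with i ≟ r
  ... | yes refl rewrite ≟-refl i | ∧-zeroʳ (c i) = cong (_xor (c i ∧ B zero j)) (sym (xor-identityʳ (B (suc i) j)))
  ... | no _ rewrite ∧-identityʳ (c i) = refl

det-addPivotRow : ∀ {m} (c : Fin m → Bool) (B : Matrix (suc m)) → det (addPivotRow c B) ≡ det B
det-addPivotRow {m} c B = det-addPivotRow′ B (allFin m) c (λ i _ → ∈-allFin i)

minor : ∀ {m} → Matrix (suc m) → Matrix m
minor C i j = C (suc i) (suc j)

-- A permutation with σ 0 ≠ 0 must send some later row to column 0.
leibnizTerm-offPivot : ∀ {m} (C : Matrix (suc m)) → (∀ i → C (suc i) zero ≡ false) →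
  ∀ y g → leibnizTerm C (consF (suc y) g) ≡ false
leibnizTerm-offPivot {m} C column y g = ≢true λ p → injective⇒onto σ (isInjective-sound σ (∧-trueˡ p)) zero (misses p)
  where
  σ : Fin (suc m) → Fin (suc m)
  σ = consF (suc y) g
  misses : leibnizTerm C σ ≡ true → ∀ i → σ i ≢ zero
  misses p (suc i) gi≡0 =
    true≢false (trans (sym (diagProduct⁻ C σ (∧-trueʳ {isInjective σ} p) (suc i))) (trans (cong (C (suc i)) gi≡0) (column i)))

leibnizTerm-pivot : ∀ {m} (C : Matrix (suc m)) h →
  leibnizTerm C (consF zero (suc ∘ h)) ≡ C zero zero ∧ leibnizTerm (minor C) h
leibnizTerm-pivot {m} C h = begin
  isInjective σ ∧ diagProduct C σ                             ≡⟨ cong₂ _∧_ injective-shift (cong andAll (allFin-suc m (λ i → C i (σ i)))) ⟩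
  isInjective h ∧ (C zero zero ∧ diagProduct (minor C) h)     ≡⟨ ∧-leftComm (isInjective h) (C zero zero) _ ⟩
  C zero zero ∧ leibnizTerm (minor C) h                       ∎
  where
  open ≡-Reasoning
  σ : Fin (suc m) → Fin (suc m)
  σ = consF zero (suc ∘ h)
  lift-inj : Injective _≡_ _≡_ h → Injective _≡_ _≡_ σ
  lift-inj h-inj {zero}  {zero}  _ = refl
  lift-inj h-inj {suc i} {suc j} e = cong suc (h-inj (suc-injective e))
  injective-shift : isInjective σ ≡ isInjective h
  injective-shift = bool-⇔
    (λ p → isInjective-complete h (λ e → suc-injective (isInjective-sound σ p (cong suc e))))
    (λ p → isInjective-complete σ (lift-inj (isInjective-sound h p)))

det-firstColumn : ∀ {m} (C : Matrix (suc m)) → (∀ i → C (suc i) zero ≡ false) →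
  det C ≡ C zero zero ∧ det (minor C)
det-firstColumn {m} C column = begin
  sumFuns (suc m) (suc m) (leibnizTerm C)
    ≡⟨ sumFuns-suc m (suc m) (leibnizTerm C) ⟩
  sumFuns m (suc m) (λ g → sumFin (suc m) (λ x → leibnizTerm C (consF x g)))
    ≡⟨ sumFuns-cong m (suc m) pivot-only ⟩
  sumFuns m (suc m) (λ g → leibnizTerm C (consF zero g))
    ≡⟨ sumFuns-avoiding-zero m m (λ g → leibnizTerm C (consF zero g)) resp avoids ⟩
  sumFuns m m (λ h → leibnizTerm C (consF zero (suc ∘ h)))
    ≡⟨ sumFuns-cong m m (leibnizTerm-pivot C) ⟩
  sumFuns m m (λ h → C zero zero ∧ leibnizTerm (minor C) h)
    ≡⟨ sum-∧ˡ (C zero zero) (leibnizTerm (minor C)) (allFuns m m) ⟩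
  C zero zero ∧ det (minor C) ∎
  where
  open ≡-Reasoning
  pivot-only : ∀ g → sumFin (suc m) (λ x → leibnizTerm C (consF x g)) ≡ leibnizTerm C (consF zero g)
  pivot-only g = trans (sumFin-suc m (λ x → leibnizTerm C (consF x g)))
    (trans (cong (leibnizTerm C (consF zero g) xor_) (sum-zero _ (allFin m) (λ y → leibnizTerm-offPivot C column y g)))
      (xor-identityʳ _))
  resp : Respects≗ (λ g → leibnizTerm C (consF zero g))
  resp g≗g′ = leibnizTerm-resp C (λ { zero → refl ; (suc i) → g≗g′ i })
  avoids : ∀ g → leibnizTerm C (consF zero g) ≡ true → ∀ i → g i ≢ zero
  avoids g p i gi≡0 with isInjective-sound (consF zero g) (∧-trueˡ p) {suc i} {zero} gi≡0
  ... | ()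

-- One step of Gaussian elimination with pivot B₀₀: the Schur complement
-- S i j = B (i+1) (j+1) − B (i+1) 0 · B 0 (j+1)  (pivot inverse is 1 over F₂).
schur : ∀ {m} → Matrix (suc m) → Matrix m
schur B i j = B (suc i) (suc j) xor (B (suc i) zero ∧ B zero (suc j))

-- Clearing the first column below a unit pivot turns the minor into the
-- Schur complement without changing det.
det-schur : ∀ {m} (B : Matrix (suc m)) → B zero zero ≡ true → det B ≡ det (schur B)
det-schur {m} B pivot = begin
  det B                       ≡⟨ sym (det-addPivotRow (λ i → B (suc i) zero) B) ⟩
  det C                       ≡⟨ det-firstColumn C cleared ⟩
  B zero zero ∧ det (schur B) ≡⟨ cong (_∧ det (schur B)) pivot ⟩
  det (schur B)               ∎
  where
  open ≡-Reasoning
  C : Matrix (suc m)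
  C = addPivotRow (λ i → B (suc i) zero) B
  cleared : ∀ i → C (suc i) zero ≡ false
  cleared i rewrite pivot | ∧-identityʳ (B (suc i) zero) = xor-same (B (suc i) zero)

-- Elimination without row exchanges and leading minors

-- Gaussian elimination without row exchanges succeeds: each pivot met is 1.
Pivotable : ∀ {n} → Matrix n → Set
Pivotable {zero}  A = ⊤
Pivotable {suc n} A = A zero zero ≡ true × Pivotable (schur A)

schur-cong : ∀ {n} {A B : Matrix (suc n)} → A ≐ B → schur A ≐ schur B
schur-cong A≐B i j = cong₂ _xor_ (A≐B (suc i) (suc j)) (cong₂ _∧_ (A≐B (suc i) zero) (A≐B zero (suc j)))

Pivotable-cong : ∀ {n} {A B : Matrix n} → A ≐ B → Pivotable A → Pivotable B
Pivotable-cong {zero}  _   _               = tt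
Pivotable-cong {suc n} A≐B (pivot , rest) = trans (sym (A≐B zero zero)) pivot , Pivotable-cong (schur-cong A≐B) rest

LeadingMinorsNonzero : ∀ {n} → Matrix n → Set
LeadingMinorsNonzero {n} A = ∀ j → 0 < j → (j≤n : j ≤ n) → det (leading j≤n A) ≡ true

-- Elimination commutes with taking leading submatrices and preserves det, so
-- the pivots are 1 exactly when the leading minors are.
det-leading-schur : ∀ {n j} (A : Matrix (suc n)) (j≤n : j ≤ n) → A zero zero ≡ true →
  det (leading (s≤s j≤n) A) ≡ det (leading j≤n (schur A))
det-leading-schur A j≤n pivot = det-schur (leading (s≤s j≤n) A) pivot

pivotable⇒leadingMinors : ∀ {n} (A : Matrix n) → Pivotable A → LeadingMinorsNonzero A
pivotable⇒leadingMinors {suc n} A (pivot , rest) (suc zero)    _ (s≤s j≤n) =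
  det-leading-schur A j≤n pivot
pivotable⇒leadingMinors {suc n} A (pivot , rest) (suc (suc j)) _ (s≤s j≤n) =
  trans (det-leading-schur A j≤n pivot) (pivotable⇒leadingMinors (schur A) rest (suc j) (s≤s z≤n) j≤n)

leadingMinors⇒pivotable : ∀ {n} (A : Matrix n) → LeadingMinorsNonzero A → Pivotable A
leadingMinors⇒pivotable {zero}  A minors = tt
leadingMinors⇒pivotable {suc n} A minors = pivot , leadingMinors⇒pivotable (schur A) minors′
  where
  pivot : A zero zero ≡ true
  pivot = trans (sym (det-1×1 (leading (s≤s z≤n) A))) (minors 1 (s≤s z≤n) (s≤s z≤n))
  minors′ : LeadingMinorsNonzero (schur A)
  minors′ j _ j≤n = trans (sym (det-leading-schur A j≤n pivot)) (minors (suc j) (s≤s z≤n) (s≤s j≤n))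

pivotable⇔leadingMinors : ∀ {n} (A : Matrix n) → Pivotable A ⇔ LeadingMinorsNonzero A
pivotable⇔leadingMinors A = mk⇔ (pivotable⇒leadingMinors A) (leadingMinors⇒pivotable A)

-- Pressing as Gaussian elimination

stateMatrix : ∀ {n} → State n → Matrix n
stateMatrix s i j = if ⌊ i ≟ j ⌋ then color s i else edge s i j

record Simple {n} (s : State n) : Set where
  field
    edge-sym      : ∀ u w → edge s u w ≡ edge s w u
    edge-loopless : ∀ u → edge s u u ≡ false

open Simple

press-simple : ∀ {n} (s : State n) v → Simple s → Simple (press s v)
press-simple s v simple = record
  { edge-sym      = λ u w → symmetric u w
  ; edge-loopless = λ u → loopless u
  }
  where
  symmetric : ∀ u w → edge (press s v) u w ≡ edge (press s v) w u
  symmetric u w rewrite edge-sym simple u w | ≟-sym u w | ∧-leftComm (inN* s v u) (inN* s v w) (not ⌊ w ≟ u ⌋) = refl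
  loopless : ∀ u → edge (press s v) u u ≡ false
  loopless u rewrite ≟-refl u | ∧-zeroʳ (inN* s v u) | ∧-zeroʳ (inN* s v u) = edge-loopless simple u

_≈S_ : ∀ {n} → State n → State n → Set
s ≈S s′ = (∀ u w → edge s u w ≡ edge s′ u w) × (∀ u → color s u ≡ color s′ u)

≈S-sym : ∀ {n} {s s′ : State n} → s ≈S s′ → s′ ≈S s
≈S-sym (E , C) = (λ u w → sym (E u w)) , (λ u → sym (C u))

press-resp : ∀ {n} {s s′ : State n} v → s ≈S s′ → press s v ≈S press s′ v
press-resp {s = s} {s′} v (E , C) = edges , colors
  where
  edges : ∀ u w → edge (press s v) u w ≡ edge (press s′ v) u w
  edges u w rewrite E v u | E v w | E u w = refl
  colors : ∀ u → color (press s v) u ≡ color (press s′ v) u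
  colors u rewrite E v u | C u = refl

successful-resp : ∀ {n} vs {s s′ : State n} → s ≈S s′ → Successful s vs → Successful s′ vs
successful-resp []       (E , C) (no-edges , all-white) =
  (λ u w → trans (sym (E u w)) (no-edges u w)) , (λ u → trans (sym (C u)) (all-white u))
successful-resp (v ∷ vs) (E , C) (black , rest) = trans (sym (C v)) black , successful-resp vs (press-resp v (E , C)) rest

deleteFirst : ∀ {n} → State (suc n) → State n
deleteFirst t = st (λ a b → edge t (suc a) (suc b)) (λ a → color t (suc a))

deleteFirst-simple : ∀ {n} (t : State (suc n)) → Simple t → Simple (deleteFirst t)
deleteFirst-simple t simple = record
  { edge-sym      = λ u w → edge-sym simple (suc u) (suc w)
  ; edge-loopless = λ u → edge-loopless simple (suc u)
  }

FirstIsolated : ∀ {n} → State (suc n) → Set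
FirstIsolated t = (∀ w → edge t zero w ≡ false) × color t zero ≡ false

-- Pressing the black vertex 0 isolates it (its closed neighbourhood is complemented).
press-first-isolates : ∀ {n} (s : State (suc n)) → Simple s → color s zero ≡ true → FirstIsolated (press s zero)
press-first-isolates s simple black = no-edges , cong not black
  where
  no-edges : ∀ w → edge (press s zero) zero w ≡ false
  no-edges zero    rewrite ∧-zeroʳ (inN* s zero zero) = edge-loopless simple zero
  no-edges (suc w) with edge s zero (suc w)
  ... | true  = refl
  ... | false = refl

press-keeps-isolated : ∀ {n} (t : State (suc n)) v → Simple t → FirstIsolated t → FirstIsolated (press t (suc v))
press-keeps-isolated t v simple (no-edges , white) = no-edges′ , trans white′ white
  where
  outside : inN* t (suc v) zero ≡ false
  outside = trans (edge-sym simple (suc v) zero) (no-edges (suc v))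
  no-edges′ : ∀ w → edge (press t (suc v)) zero w ≡ false
  no-edges′ w rewrite outside = no-edges w
  white′ : color (press t (suc v)) zero ≡ color t zero
  white′ rewrite outside = refl

deleteFirst-press : ∀ {n} (t : State (suc n)) v → deleteFirst (press t (suc v)) ≈S press (deleteFirst t) v
deleteFirst-press t v = edges , colors
  where
  edges : ∀ u w → edge (deleteFirst (press t (suc v))) u w ≡ edge (press (deleteFirst t) v) u w
  edges u w rewrite ≟-suc u v | ≟-suc w v | ≟-suc u w = refl
  colors : ∀ u → color (deleteFirst (press t (suc v))) u ≡ color (press (deleteFirst t) v) u
  colors u rewrite ≟-suc u v = refl

successful-deleteFirst⁺ : ∀ {n} vs (t : State (suc n)) → Simple t → FirstIsolated t →
  Successful t (map suc vs) → Successful (deleteFirst t) vs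
successful-deleteFirst⁺ [] t _ _ (no-edges , all-white) = (λ u w → no-edges (suc u) (suc w)) , (λ u → all-white (suc u))
successful-deleteFirst⁺ (v ∷ vs) t simple isolated (black , rest) =
  black , successful-resp vs (deleteFirst-press t v)
            (successful-deleteFirst⁺ vs (press t (suc v)) (press-simple t (suc v) simple)
              (press-keeps-isolated t v simple isolated) rest)

successful-deleteFirst⁻ : ∀ {n} vs (t : State (suc n)) → Simple t → FirstIsolated t →
  Successful (deleteFirst t) vs → Successful t (map suc vs)
successful-deleteFirst⁻ [] t simple (no-edges , white) (no-edges′ , all-white) = edges , colors
  where
  edges : ∀ u w → edge t u w ≡ false
  edges zero    w       = no-edges w
  edges (suc u) zero    = trans (edge-sym simple (suc u) zero) (no-edges (suc u))
  edges (suc u) (suc w) = no-edges′ u w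
  colors : ∀ u → color t u ≡ false
  colors zero    = white
  colors (suc u) = all-white u
successful-deleteFirst⁻ (v ∷ vs) t simple isolated (black , rest) =
  black , successful-deleteFirst⁻ vs (press t (suc v)) (press-simple t (suc v) simple)
            (press-keeps-isolated t v simple isolated) (successful-resp vs (≈S-sym (deleteFirst-press t v)) rest)

press-schur : ∀ {n} (s : State (suc n)) → Simple s → stateMatrix (deleteFirst (press s zero)) ≐ schur (stateMatrix s)
press-schur s simple i j rewrite ≟-suc i j | edge-sym simple (suc i) zero with i ≟ j
... | yes refl with edge s zero (suc i) | color s (suc i)
...   | true  | true  = refl
...   | true  | false = refl
...   | false | c     = sym (xor-identityʳ c)
press-schur s simple i j | no _ with edge s zero (suc i) | edge s zero (suc j) | edge s (suc i) (suc j)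
...   | true  | true  | true  = refl
...   | true  | true  | false = refl
...   | true  | false | x     = sym (xor-identityʳ x)
...   | false | _     | x     = sym (xor-identityʳ x)

successful⇒pivotable : ∀ {n} (s : State n) → Simple s → Successful s (allFin n) → Pivotable (stateMatrix s)
successful⇒pivotable {zero}  s simple _ = tt
successful⇒pivotable {suc n} s simple succeeds with subst (Successful s) (allFin-unfold n) succeeds
... | black , rest = black , Pivotable-cong (press-schur s simple)
        (successful⇒pivotable (deleteFirst s′) (deleteFirst-simple s′ simple′)
          (successful-deleteFirst⁺ (allFin n) s′ simple′ (press-first-isolates s simple black) rest))
  where
  s′ : State (suc n)
  s′ = press s zero
  simple′ : Simple s′
  simple′ = press-simple s zero simple

pivotable⇒successful : ∀ {n} (s : State n) → Simple s → Pivotable (stateMatrix s) → Successful s (allFin n)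
pivotable⇒successful {zero}  s simple _ = (λ ()) , (λ ())
pivotable⇒successful {suc n} s simple (black , rest) = subst (Successful s) (sym (allFin-unfold n))
  (black , successful-deleteFirst⁻ (allFin n) s′ simple′ (press-first-isolates s simple black)
             (pivotable⇒successful (deleteFirst s′) (deleteFirst-simple s′ simple′)
               (Pivotable-cong (λ a b → sym (press-schur s simple a b)) rest)))
  where
  s′ : State (suc n)
  s′ = press s zero
  simple′ : Simple s′
  simple′ = press-simple s zero simple

⊗-suc : ∀ {m} (X Y : Matrix (suc m)) i k →
  (X ⊗ Y) i k ≡ (X i zero ∧ Y zero k) xor sumFin m (λ j → X i (suc j) ∧ Y (suc j) k)
⊗-suc {m} X Y i k = sumFin-suc m (λ j → X i j ∧ Y j k)

⊗-minor : ∀ {m} (X Y : Matrix (suc m)) i k →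
  (X ⊗ Y) (suc i) (suc k) ≡ (X (suc i) zero ∧ Y zero (suc k)) xor (minor X ⊗ minor Y) i k
⊗-minor X Y i k = ⊗-suc X Y (suc i) (suc k)

transpose-⊗ : ∀ {m} (X Y : Matrix m) → (transpose X ⊗ transpose Y) ≐ transpose (Y ⊗ X)
transpose-⊗ {m} X Y i k = sum-cong (allFin m) (λ j → ∧-comm (X j i) (Y k j))

transpose-invertible : ∀ {m} (X : Matrix m) → Invertible X → Invertible (transpose X)
transpose-invertible X (Y , XY , YX) =
  transpose Y , (λ i k → trans (transpose-⊗ X Y i k) (trans (YX k i) (≟-sym k i)))
              , (λ i k → trans (transpose-⊗ Y X i k) (trans (XY k i) (≟-sym k i)))

transpose-lower : ∀ {m} (L : Matrix m) → LowerTriangular L → UpperTriangular (transpose L)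
transpose-lower L lower i j j<i = lower j i j<i

transpose-upper : ∀ {m} (U : Matrix m) → UpperTriangular U → LowerTriangular (transpose U)
transpose-upper U upper i j i<j = upper j i i<j

_·_ : ∀ {m} → Matrix m → (Fin m → Bool) → Fin m → Bool
(M · a) i = sumFin _ (λ j → M i j ∧ a j)

·-assoc : ∀ {m} (L M : Matrix m) a i → (L · (M · a)) i ≡ ((L ⊗ M) · a) i
·-assoc {m} L M a i = begin
  sumFin m (λ j → L i j ∧ sumFin m (λ k → M j k ∧ a k))
    ≡⟨ sum-cong (allFin m) (λ j → sym (sum-∧ˡ (L i j) (λ k → M j k ∧ a k) (allFin m))) ⟩
  sumFin m (λ j → sumFin m (λ k → L i j ∧ (M j k ∧ a k)))
    ≡⟨ sum-swap (λ j k → L i j ∧ (M j k ∧ a k)) (allFin m) (allFin m) ⟩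
  sumFin m (λ k → sumFin m (λ j → L i j ∧ (M j k ∧ a k)))
    ≡⟨ sum-cong (allFin m) (λ k → trans (sum-cong (allFin m) (λ j → sym (∧-assoc (L i j) (M j k) (a k))))
                                        (sum-∧ʳ (a k) (λ j → L i j ∧ M j k) (allFin m))) ⟩
  sumFin m (λ k → (L ⊗ M) i k ∧ a k) ∎
  where open ≡-Reasoning

·-identity : ∀ {m} (a : Fin m → Bool) i → (idM · a) i ≡ a i
·-identity {m} a i = sumFin-δ m i a

·-inverse : ∀ {m} (L M : Matrix m) → (L ⊗ M) ≐ idM → ∀ a i → (L · (M · a)) i ≡ a i
·-inverse {m} L M LM a i = trans (·-assoc L M a i)
  (trans (sum-cong (allFin m) (λ k → cong (_∧ a k) (LM i k))) (·-identity a i))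

bordered : ∀ {m} → (Fin m → Bool) → Matrix m → Matrix (suc m)
bordered a L zero    zero    = true
bordered a L zero    (suc j) = false
bordered a L (suc i) zero    = a i
bordered a L (suc i) (suc j) = L i j

bordered-lower : ∀ {m} a (L : Matrix m) → LowerTriangular L → LowerTriangular (bordered a L)
bordered-lower a L lower zero    (suc j) _         = refl
bordered-lower a L lower (suc i) (suc j) (s≤s i<j) = lower i j i<j

bordered-⊗ : ∀ {m} a (L : Matrix m) b M → (bordered a L ⊗ bordered b M) ≐ bordered (λ i → a i xor (L · b) i) (L ⊗ M)
bordered-⊗ {m} a L b M zero    zero    = trans (⊗-suc (bordered a L) (bordered b M) zero zero) (cong (true xor_) (sum-zero _ (allFin m) (λ _ → refl)))
bordered-⊗ {m} a L b M zero    (suc k) = trans (⊗-suc (bordered a L) (bordered b M) zero (suc k)) (sum-zero _ (allFin m) (λ _ → refl))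
bordered-⊗ {m} a L b M (suc i) zero    = trans (⊗-suc (bordered a L) (bordered b M) (suc i) zero) (cong (_xor (L · b) i) (∧-identityʳ (a i)))
bordered-⊗ {m} a L b M (suc i) (suc k) = trans (⊗-minor (bordered a L) (bordered b M) i k) (cong (_xor (L ⊗ M) i k) (∧-zeroʳ (a i)))

bordered-identity : ∀ {m} (c : Fin m → Bool) (K : Matrix m) → (∀ i → c i ≡ false) → K ≐ idM → bordered c K ≐ idM
bordered-identity c K c≡0 K≐1 zero    zero    = refl
bordered-identity c K c≡0 K≐1 zero    (suc k) = refl
bordered-identity c K c≡0 K≐1 (suc i) zero    = c≡0 i
bordered-identity c K c≡0 K≐1 (suc i) (suc k) = trans (K≐1 i k) (sym (≟-suc i k))

-- [[1, 0], [a, L]] has inverse [[1, 0], [−L⁻¹a, L⁻¹]].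
bordered-invertible : ∀ {m} a (L : Matrix m) → Invertible L → Invertible (bordered a L)
bordered-invertible a L (M , LM , ML) =
  bordered (M · a) M ,
  (λ i k → trans (bordered-⊗ a L (M · a) M i k)
                 (bordered-identity _ _ (λ j → trans (cong (a j xor_) (·-inverse L M LM a j)) (xor-same (a j))) LM i k)) ,
  (λ i k → trans (bordered-⊗ (M · a) M a L i k)
                 (bordered-identity _ _ (λ j → xor-same ((M · a) j)) ML i k))

-- Cholesky factorisation

Symmetric : ∀ {m} → Matrix m → Set
Symmetric A = ∀ i j → A i j ≡ A j i

-- One step: for symmetric A with unit pivot, a factorisation of the Schur
-- complement extends by the first column of A.
cholesky-step : ∀ {m} (A : Matrix (suc m)) (L : Matrix m) → Symmetric A → A zero zero ≡ true →
  schur A ≐ (L ⊗ transpose L) →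
  A ≐ (bordered (λ i → A (suc i) zero) L ⊗ transpose (bordered (λ i → A (suc i) zero) L))
cholesky-step {m} A L sym-A pivot factor = entry
  where
  a : Fin m → Bool
  a i = A (suc i) zero
  B : Matrix (suc m)
  B = bordered a L
  entry : A ≐ (B ⊗ transpose B)
  entry zero zero = sym (trans (⊗-suc B (transpose B) zero zero)
    (trans (cong (true xor_) (sum-zero _ (allFin m) (λ _ → refl))) (sym pivot)))
  entry zero (suc k) = trans (sym-A zero (suc k)) (sym (trans (⊗-suc B (transpose B) zero (suc k))
    (trans (cong (a k xor_) (sum-zero _ (allFin m) (λ _ → refl))) (xor-identityʳ (a k)))))
  entry (suc i) zero = sym (trans (⊗-suc B (transpose B) (suc i) zero)
    (trans (cong₂ _xor_ (∧-identityʳ (a i)) (sum-zero _ (allFin m) (λ j → ∧-zeroʳ (L i j)))) (xor-identityʳ (a i))))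
  entry (suc i) (suc k) = sym (begin
    (B ⊗ transpose B) (suc i) (suc k)                          ≡⟨ ⊗-minor B (transpose B) i k ⟩
    (a i ∧ a k) xor (L ⊗ transpose L) i k                      ≡⟨ cong ((a i ∧ a k) xor_) (sym (factor i k)) ⟩
    (a i ∧ a k) xor (A (suc i) (suc k) xor (a i ∧ A zero (suc k)))
                                                               ≡⟨ cong (λ x → (a i ∧ a k) xor (A (suc i) (suc k) xor (a i ∧ x))) (sym-A zero (suc k)) ⟩
    (a i ∧ a k) xor (A (suc i) (suc k) xor (a i ∧ a k))        ≡⟨ cong ((a i ∧ a k) xor_) (xor-comm (A (suc i) (suc k)) (a i ∧ a k)) ⟩
    (a i ∧ a k) xor ((a i ∧ a k) xor A (suc i) (suc k))        ≡⟨ xor-cancelˡ (a i ∧ a k) (A (suc i) (suc k)) ⟩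
    A (suc i) (suc k)                                          ∎)
    where open ≡-Reasoning

schur-symmetric : ∀ {m} (A : Matrix (suc m)) → Symmetric A → Symmetric (schur A)
schur-symmetric A sym-A i j = cong₂ _xor_ (sym-A (suc i) (suc j))
  (trans (cong₂ _∧_ (sym-A (suc i) zero) (sym-A zero (suc j))) (∧-comm (A zero (suc i)) (A (suc j) zero)))

CholeskyFactorisation : ∀ {n} → Matrix n → Set
CholeskyFactorisation {n} A = Σ (Matrix n) λ L → LowerTriangular L × Invertible L × (A ≐ (L ⊗ transpose L))

pivotable⇒cholesky : ∀ {n} (A : Matrix n) → Symmetric A → Pivotable A → CholeskyFactorisation A
pivotable⇒cholesky {zero}  A _ _ = A , (λ ()) , (A , (λ ()) , (λ ())) , (λ ())
pivotable⇒cholesky {suc n} A sym-A (pivot , rest)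
  with L , lower , invertible , factor ← pivotable⇒cholesky (schur A) (schur-symmetric A sym-A) rest =
  bordered a L , bordered-lower a L lower , bordered-invertible a L invertible , cholesky-step A L sym-A pivot factor
  where
  a : Fin n → Bool
  a i = A (suc i) zero

-- LU factorisations force unit pivots

LUFactorisation : ∀ {n} → Matrix n → Set
LUFactorisation {n} A = Σ (Matrix n) λ L → Σ (Matrix n) λ U →
  LowerTriangular L × Invertible L × UpperTriangular U × Invertible U × (A ≐ (L ⊗ U))

cholesky⇒lu : ∀ {n} {A : Matrix n} → CholeskyFactorisation A → LUFactorisation A
cholesky⇒lu (L , lower , invertible , factor) =
  L , transpose L , lower , invertible , transpose-lower L lower , transpose-invertible L invertible , factor

⊗-firstRow : ∀ {m} (X Y : Matrix (suc m)) → (∀ j → X zero (suc j) ≡ false) → ∀ k → (X ⊗ Y) zero k ≡ X zero zero ∧ Y zero k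
⊗-firstRow {m} X Y row k = trans (⊗-suc X Y zero k)
  (trans (cong ((X zero zero ∧ Y zero k) xor_) (sum-zero _ (allFin m) (λ j → cong (_∧ Y (suc j) k) (row j))))
    (xor-identityʳ _))

⊗-firstColumn : ∀ {m} (X Y : Matrix (suc m)) → (∀ j → Y (suc j) zero ≡ false) → ∀ i → (X ⊗ Y) i zero ≡ X i zero ∧ Y zero zero
⊗-firstColumn {m} X Y column i = trans (⊗-suc X Y i zero)
  (trans (cong ((X i zero ∧ Y zero zero) xor_) (sum-zero _ (allFin m) (λ j → trans (cong (X i (suc j) ∧_) (column j)) (∧-zeroʳ _))))
    (xor-identityʳ _))

minor-⊗ : ∀ {m} (X Y : Matrix (suc m)) → (∀ i k → (X (suc i) zero ∧ Y zero (suc k)) ≡ false) →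
  minor (X ⊗ Y) ≐ (minor X ⊗ minor Y)
minor-⊗ X Y cross i k = trans (⊗-minor X Y i k) (cong (_xor (minor X ⊗ minor Y) i k) (cross i k))

minor-identity : ∀ {m} (X : Matrix (suc m)) → X ≐ idM → minor X ≐ idM
minor-identity X X≐1 i k = trans (X≐1 (suc i) (suc k)) (≟-suc i k)

-- An invertible lower-triangular matrix has unit pivot and invertible minor
-- (its inverse has first row (1 0 … 0)).
lower-invertible-minor : ∀ {m} (L : Matrix (suc m)) → LowerTriangular L → Invertible L →
  L zero zero ≡ true × Invertible (minor L)
lower-invertible-minor {m} L lower (M , LM , ML) = pivot , minor M , inverse-right , inverse-left
  where
  row : ∀ j → L zero (suc j) ≡ false
  row j = lower zero (suc j) (s≤s z≤n)
  pivot : L zero zero ≡ true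
  pivot = ∧-trueˡ (trans (sym (⊗-firstRow L M row zero)) (LM zero zero))
  M-row : ∀ k → M zero (suc k) ≡ false
  M-row k = trans (cong (_∧ M zero (suc k)) (sym pivot)) (trans (sym (⊗-firstRow L M row (suc k))) (LM zero (suc k)))
  inverse-right : (minor L ⊗ minor M) ≐ idM
  inverse-right i k = trans (sym (minor-⊗ L M (λ i k → trans (cong (L (suc i) zero ∧_) (M-row k)) (∧-zeroʳ _)) i k))
                            (minor-identity (L ⊗ M) LM i k)
  inverse-left : (minor M ⊗ minor L) ≐ idM
  inverse-left i k = trans (sym (minor-⊗ M L (λ i k → trans (cong (M (suc i) zero ∧_) (row k)) (∧-zeroʳ _)) i k))
                           (minor-identity (M ⊗ L) ML i k)

upper-invertible-minor : ∀ {m} (U : Matrix (suc m)) → UpperTriangular U → Invertible U →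
  U zero zero ≡ true × Invertible (minor U)
upper-invertible-minor U upper invertible
  with pivot , invertible′ ← lower-invertible-minor (transpose U) (transpose-upper U upper) (transpose-invertible U invertible) =
  pivot , transpose-invertible (minor (transpose U)) invertible′

lu-step : ∀ {m} (A L U : Matrix (suc m)) → LowerTriangular L → L zero zero ≡ true →
  UpperTriangular U → U zero zero ≡ true → A ≐ (L ⊗ U) →
  A zero zero ≡ true × schur A ≐ (minor L ⊗ minor U)
lu-step A L U lower L-pivot upper U-pivot factor = pivot , schur-factor
  where
  row : ∀ j → L zero (suc j) ≡ false
  row j = lower zero (suc j) (s≤s z≤n)
  column : ∀ j → U (suc j) zero ≡ false
  column j = upper (suc j) zero (s≤s z≤n)
  pivot : A zero zero ≡ true
  pivot = trans (factor zero zero) (trans (⊗-firstRow L U row zero) (cong₂ _∧_ L-pivot U-pivot))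
  A-column : ∀ i → A (suc i) zero ≡ L (suc i) zero
  A-column i = trans (factor (suc i) zero) (trans (⊗-firstColumn L U column (suc i))
                 (trans (cong (L (suc i) zero ∧_) U-pivot) (∧-identityʳ _)))
  A-row : ∀ k → A zero (suc k) ≡ U zero (suc k)
  A-row k = trans (factor zero (suc k)) (trans (⊗-firstRow L U row (suc k)) (cong (_∧ U zero (suc k)) L-pivot))
  schur-factor : schur A ≐ (minor L ⊗ minor U)
  schur-factor i k = begin
    A (suc i) (suc k) xor (A (suc i) zero ∧ A zero (suc k))
      ≡⟨ cong₂ (λ x y → x xor y) (trans (factor (suc i) (suc k)) (⊗-minor L U i k)) (cong₂ _∧_ (A-column i) (A-row k)) ⟩
    (c xor (minor L ⊗ minor U) i k) xor c
      ≡⟨ xor-comm (c xor (minor L ⊗ minor U) i k) c ⟩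
    c xor (c xor (minor L ⊗ minor U) i k)
      ≡⟨ xor-cancelˡ c ((minor L ⊗ minor U) i k) ⟩
    (minor L ⊗ minor U) i k ∎
    where
    open ≡-Reasoning
    c : Bool
    c = L (suc i) zero ∧ U zero (suc k)

lu⇒pivotable : ∀ {n} (A L U : Matrix n) → LowerTriangular L → Invertible L → UpperTriangular U → Invertible U →
  A ≐ (L ⊗ U) → Pivotable A
lu⇒pivotable {zero}  A L U _ _ _ _ _ = tt
lu⇒pivotable {suc n} A L U lower L-inv upper U-inv factor
  with L-pivot , L-inv′ ← lower-invertible-minor L lower L-inv
     | U-pivot , U-inv′ ← upper-invertible-minor U upper U-inv
  with pivot , schur-factor ← lu-step A L U lower L-pivot upper U-pivot factor =
  pivot , lu⇒pivotable (schur A) (minor L) (minor U) (λ i j i<j → lower (suc i) (suc j) (s≤s i<j)) L-inv′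
                        (λ i j j<i → upper (suc i) (suc j) (s≤s j<i)) U-inv′ schur-factor

firstWhere : ∀ {n} → (Fin n → Bool) → Maybe (Fin n)
firstWhere {zero}  p = nothing
firstWhere {suc n} p = if p zero then just zero else Maybe.map suc (firstWhere (p ∘ suc))

firstWhere-cong : ∀ {n} {p q : Fin n → Bool} → p ≗ q → firstWhere p ≡ firstWhere q
firstWhere-cong {zero}  p≗q = refl
firstWhere-cong {suc n} {p} {q} p≗q rewrite p≗q zero | firstWhere-cong {p = p ∘ suc} {q ∘ suc} (p≗q ∘ suc) = refl

firstWhere-just : ∀ {n} (p : Fin n → Bool) {i} → firstWhere p ≡ just i → p i ≡ true
firstWhere-just {suc n} p e with p zero in p0 | firstWhere (p ∘ suc) in found
firstWhere-just {suc n} p refl | true  | _      = p0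
firstWhere-just {suc n} p refl | false | just i = firstWhere-just (p ∘ suc) found

firstWhere-nothing : ∀ {n} (p : Fin n → Bool) → firstWhere p ≡ nothing → ∀ i → p i ≡ false
firstWhere-nothing {suc n} p e i with p zero in p0 | firstWhere (p ∘ suc) in found
firstWhere-nothing {suc n} p refl zero    | false | nothing = p0
firstWhere-nothing {suc n} p refl (suc i) | false | nothing = firstWhere-nothing (p ∘ suc) found i

-- σ⁻¹ j is the first preimage of j (for a non-surjective σ, anything).
inverse : ∀ {m} → (Fin m → Fin m) → Fin m → Fin m
inverse σ j = fromMaybe j (firstWhere (λ i → ⌊ σ i ≟ j ⌋))

inverse-cong : ∀ {m} {σ τ : Fin m → Fin m} → σ ≗ τ → inverse σ ≗ inverse τ
inverse-cong σ≗τ j = cong (fromMaybe j) (firstWhere-cong (λ i → cong (λ x → ⌊ x ≟ j ⌋) (σ≗τ i)))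

inverseʳ : ∀ {m} (σ : Fin m → Fin m) → Injective _≡_ _≡_ σ → ∀ j → σ (inverse σ j) ≡ j
inverseʳ σ σ-inj j with firstWhere (λ i → ⌊ σ i ≟ j ⌋) in found
... | just i  = ≟-sound (firstWhere-just _ found)
... | nothing = contradiction (λ i σi≡j → true≢false (trans (sym (hit σi≡j)) (firstWhere-nothing _ found i)))
                              (injective⇒onto σ σ-inj j)
  where
  hit : ∀ {i} → σ i ≡ j → ⌊ σ i ≟ j ⌋ ≡ true
  hit refl = ≟-refl _

inverseˡ : ∀ {m} (σ : Fin m → Fin m) → Injective _≡_ _≡_ σ → ∀ i → inverse σ (σ i) ≡ i
inverseˡ σ σ-inj i = σ-inj (inverseʳ σ σ-inj (σ i))

inverse-injective : ∀ {m} (σ : Fin m → Fin m) → Injective _≡_ _≡_ σ → Injective _≡_ _≡_ (inverse σ)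
inverse-injective σ σ-inj {a} {b} e = trans (sym (inverseʳ σ σ-inj a)) (trans (cong σ e) (inverseʳ σ σ-inj b))

Involutive : ∀ {m} → (Fin m → Fin m) → Set
Involutive σ = ∀ i → σ (σ i) ≡ i

involutive⇒injective : ∀ {m} (σ : Fin m → Fin m) → Involutive σ → Injective _≡_ _≡_ σ
involutive⇒injective σ invol {i} {j} e = trans (sym (invol i)) (trans (cong σ e) (invol j))

-- Perfect matchings versus the determinant

-- The loopy graph with edges e and loops ℓ, encoded by the symmetric matrix B
-- (loops on the diagonal).  Its perfect matchings are exactly the involutive
-- permutations in the Leibniz expansion of det B; the remaining permutations
-- pair off with their inverses, so the two counts agree mod 2.
module Matchings {m} (B : Matrix m) (e : Fin m → Fin m → Bool) (ℓ : Fin m → Bool)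
  (B-sym : Symmetric B) (loops : ∀ a → ℓ a ≡ B a a) (edges : ∀ a b → a ≢ b → e a b ≡ B a b) where

  matching : (Fin m → Fin m) → Bool
  matching = isPerfectMatching e ℓ

  pair-entry : ∀ (σ : Fin m → Fin m) i → (if ⌊ σ i ≟ i ⌋ then ℓ i else e i (σ i)) ≡ B i (σ i)
  pair-entry σ i with σ i ≟ i
  ... | yes σi≡i = trans (loops i) (cong (B i) (sym σi≡i))
  ... | no σi≢i  = edges i (σ i) (λ i≡σi → σi≢i (sym i≡σi))

  matching-test : (Fin m → Fin m) → Fin m → Bool
  matching-test σ i = ⌊ σ (σ i) ≟ i ⌋ ∧ (if ⌊ σ i ≟ i ⌋ then ℓ i else e i (σ i))

  matching⁻ : ∀ σ → matching σ ≡ true → Involutive σ × diagProduct B σ ≡ true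
  matching⁻ σ p = (λ i → ≟-sound (∧-trueˡ (test i)))
                , diagProduct⁺ B σ (λ i → trans (sym (pair-entry σ i)) (∧-trueʳ {⌊ σ (σ i) ≟ i ⌋} (test i)))
    where
    test : ∀ i → matching-test σ i ≡ true
    test = andAll-allFin⁻ m (matching-test σ) p

  matching⁺ : ∀ σ → Involutive σ → diagProduct B σ ≡ true → matching σ ≡ true
  matching⁺ σ invol p = andAll-allFin⁺ m (matching-test σ)
    (λ i → ∧-true (trans (cong (λ x → ⌊ x ≟ i ⌋) (invol i)) (≟-refl i)) (trans (pair-entry σ i) (diagProduct⁻ B σ p i)))

  matching-resp : Respects≗ matching
  matching-resp {σ} {τ} σ≗τ = bool-⇔ (transfer σ≗τ) (transfer (λ i → sym (σ≗τ i)))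
    where
    transfer : ∀ {σ τ} → σ ≗ τ → matching σ ≡ true → matching τ ≡ true
    transfer {σ} {τ} σ≗τ p with invol , prod ← matching⁻ σ p =
      matching⁺ τ (λ i → trans (cong τ (sym (σ≗τ i))) (trans (sym (σ≗τ (σ i))) (invol i)))
                  (trans (sym (diagProduct-cong B B (λ i → cong (B i) (σ≗τ i)))) prod)

  unmatched : (Fin m → Fin m) → Bool
  unmatched σ = leibnizTerm B σ xor matching σ

  unmatched⁻ : ∀ σ → unmatched σ ≡ true → Injective _≡_ _≡_ σ × diagProduct B σ ≡ true × ¬ Involutive σ
  unmatched⁻ σ p with isInjective σ in inj | diagProduct B σ in prod | matching σ in match
  ... | true  | true  | false = isInjective-sound σ inj , refl , λ invol → true≢false (trans (sym (matching⁺ σ invol prod)) match)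
  ... | _     | false | true  = contradiction (trans (sym (proj₂ (matching⁻ σ match))) prod) true≢false
  ... | false | true  | true  = contradiction (trans (sym (isInjective-complete σ (involutive⇒injective σ (proj₁ (matching⁻ σ match))))) inj) true≢false

  unmatched⁺ : ∀ σ → Injective _≡_ _≡_ σ → diagProduct B σ ≡ true → ¬ Involutive σ → unmatched σ ≡ true
  unmatched⁺ σ σ-inj prod not-invol rewrite isInjective-complete σ σ-inj | prod with matching σ in match
  ... | false = refl
  ... | true  = contradiction (proj₁ (matching⁻ σ match)) not-invol

  unmatched-resp : Respects≗ unmatched
  unmatched-resp σ≗τ = cong₂ _xor_ (leibnizTerm-resp B σ≗τ) (matching-resp σ≗τ)

  self-inverse⇒involutive : ∀ (σ : Fin m → Fin m) → Injective _≡_ _≡_ σ → inverse σ ≗ σ → Involutive σ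
  self-inverse⇒involutive σ σ-inj σ⁻¹≗σ i = trans (cong σ (sym (σ⁻¹≗σ i))) (inverseʳ σ σ-inj i)

  -- σ ↦ σ⁻¹ pairs off the unmatched terms (B symmetric makes B j (σ⁻¹ j) = B (σ⁻¹ j) j).
  inverse-pairsOff : PairsOff unmatched (inverse {m})
  inverse-pairsOff = record
    { H-resp     = unmatched-resp
    ; τ-cong     = inverse-cong
    ; involutive = involutive
    ; supported  = supported
    ; fixfree    = λ σ p σ⁻¹≗σ → let σ-inj , _ , not-invol = unmatched⁻ σ p in
                                    not-invol (self-inverse⇒involutive σ σ-inj σ⁻¹≗σ)
    }
    where
    involutive : ∀ σ → unmatched σ ≡ true → inverse (inverse σ) ≗ σ
    involutive σ p i with σ-inj , _ ← unmatched⁻ σ p =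
      inverse-injective σ σ-inj (trans (inverseʳ (inverse σ) (inverse-injective σ σ-inj) i) (sym (inverseˡ σ σ-inj i)))
    supported : ∀ σ → unmatched σ ≡ true → unmatched (inverse σ) ≡ true
    supported σ p with σ-inj , prod , not-invol ← unmatched⁻ σ p =
      unmatched⁺ (inverse σ) (inverse-injective σ σ-inj)
        (diagProduct⁺ B (inverse σ) (λ j → trans (B-sym j (inverse σ j))
          (trans (cong (B (inverse σ j)) (sym (inverseʳ σ σ-inj j))) (diagProduct⁻ B σ prod (inverse σ j)))))
        (λ invol → not-invol (self-inverse⇒involutive σ σ-inj
          (λ j → trans (sym (inverseʳ σ σ-inj (inverse σ j))) (cong σ (invol j)))))

  matchingParity≡det : pmParity e ℓ ≡ det B
  matchingParity≡det = sym (xor-≡false (trans (sym (sum-xor (leibnizTerm B) matching (allFuns m m)))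
                                             (sumFuns-involution m m unmatched (inverse {m}) inverse-pairsOff)))

luFactorisation⇒pivotable : ∀ {n} (A : Matrix n) → LUFactorisation A → Pivotable A
luFactorisation⇒pivotable A (L , U , lower , L-inv , upper , U-inv , factor) = lu⇒pivotable A L U lower L-inv upper U-inv factor

pivotable⇔cholesky : ∀ {n} (A : Matrix n) → Symmetric A → Pivotable A ⇔ CholeskyFactorisation A
pivotable⇔cholesky A sym-A = mk⇔ (pivotable⇒cholesky A sym-A) (luFactorisation⇒pivotable A ∘ cholesky⇒lu)

pivotable⇔lu : ∀ {n} (A : Matrix n) → Symmetric A → Pivotable A ⇔ LUFactorisation A
pivotable⇔lu A sym-A = mk⇔ (cholesky⇒lu ∘ pivotable⇒cholesky A sym-A) (luFactorisation⇒pivotable A)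

toState-simple : ∀ {n} (G : BiGraph n) → Simple (toState G)
toState-simple G = record { edge-sym = BiGraph.sym G ; edge-loopless = irrefl G }

augAdj-symmetric : ∀ {n} (G : BiGraph n) → Symmetric (augAdj G)
augAdj-symmetric G i j with i ≟ j | j ≟ i
... | yes refl | yes _   = refl
... | yes i≡j  | no j≢i  = contradiction (sym i≡j) j≢i
... | no i≢j   | yes j≡i = contradiction (sym j≡i) i≢j
... | no _     | no _    = BiGraph.sym G i j

pressing⇔pivotable : ∀ {n} (G : BiGraph n) → Successful (toState G) (allFin n) ⇔ Pivotable (augAdj G)
pressing⇔pivotable G =
  mk⇔ (successful⇒pivotable (toState G) (toState-simple G)) (pivotable⇒successful (toState G) (toState-simple G))

-- The leading j × j submatrix of A(G) encodes the loopy graph Ĝ[{1,…,j}].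
matchingParity≡leadingMinor : ∀ {n j} (G : BiGraph n) (j≤n : j ≤ n) → loopyPMParity j≤n G ≡ det (leading j≤n (augAdj G))
matchingParity≡leadingMinor {n} {j} G j≤n =
  Matchings.matchingParity≡det (leading j≤n (augAdj G)) (λ a b → adj G (ι a) (ι b)) (λ a → black G (ι a))
    (λ a b → augAdj-symmetric G (ι a) (ι b)) loops edges
  where
  ι : Fin j → Fin n
  ι a = inject≤ a j≤n
  loops : ∀ a → black G (ι a) ≡ leading j≤n (augAdj G) a a
  loops a rewrite ≟-refl (ι a) = refl
  edges : ∀ a b → a ≢ b → adj G (ι a) (ι b) ≡ leading j≤n (augAdj G) a b
  edges a b a≢b rewrite ≟-≢ {i = ι a} {ι b} (λ e → a≢b (inject≤-injective j≤n j≤n a b e)) = refl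

leadingMinors⇔matchings : ∀ {n} (G : BiGraph n) →
  LeadingMinorsNonzero (augAdj G) ⇔ (∀ j → 0 < j → (j≤n : j ≤ n) → loopyPMParity j≤n G ≡ true)
leadingMinors⇔matchings G =
  mk⇔ (λ minors j 0<j j≤n → trans (matchingParity≡leadingMinor G j≤n) (minors j 0<j j≤n))
      (λ parities j 0<j j≤n → trans (sym (matchingParity≡leadingMinor G j≤n)) (parities j 0<j j≤n))

theorem2 : ∀ {n : ℕ} (G : BiGraph n) →
  let
    c1 = Successful (toState G) (allFin n)
    c2 = Σ (Matrix n) λ L → LowerTriangular L × Invertible L × (augAdj G ≐ (L ⊗ transpose L))
    c3 = ∀ j → 0 < j → (j≤n : j ≤ n) → det (leading j≤n (augAdj G)) ≡ true
    c4 = ∀ j → 0 < j → (j≤n : j ≤ n) → loopyPMParity j≤n G ≡ true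
    c5 = Σ (Matrix n) λ L → Σ (Matrix n) λ U →
           LowerTriangular L × Invertible L × UpperTriangular U × Invertible U
           × (augAdj G ≐ (L ⊗ U))
  in (c1 ⇔ c2) × (c1 ⇔ c3) × (c1 ⇔ c4) × (c1 ⇔ c5)
theorem2 {n} G =
  pivotable⇔cholesky A (augAdj-symmetric G) ⇔-∘ pressing⇔pivotable G ,
  c1⇔c3 ,
  leadingMinors⇔matchings G ⇔-∘ c1⇔c3 ,
  pivotable⇔lu A (augAdj-symmetric G) ⇔-∘ pressing⇔pivotable G
  where
  A : Matrix n
  A = augAdj G
  c1⇔c3 : Successful (toState G) (allFin n) ⇔ LeadingMinorsNonzero A
  c1⇔c3 = pivotable⇔leadingMinors A ⇔-∘ pressing⇔pivotable G
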